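{- Let $A$ be a set, $S\subseteq A$, $p$ a prime, $s\ge1$, $\varphi:S\to\mathbb Z_p^s$ a surjective map, and $R=\{(a_1,a_2,a_3,a_4)\in S^4:\varphi(a_1)+\varphi(a_2)=\varphi(a_3)+\varphi(a_4)\}$. Then $R$ is not preserved by any idempotent WNU operation on $A$ of arity $n$ with $p$ dividing $n$.
   Context: An operation $w$ is idempotent if $w(x,\dots,x)=x$. A WNU operation is an operation $w$ of arity $n\ge2$ satisfying $w(y,x,\dots,x)=w(x,y,x,\dots,x)=\dots=w(x,\dots,x,y)$ for all $x,y$. An $n$-ary operation preserves $R$ if applying it coordinatewise to any $n$ tuples of $R$ gives a tuple of $R$. -}

module Defs where

open import Level using (Level)
open import Data.Nat using (ℕ; _+_; _≤_)
open import Data.Nat.Primality using (Prime; prime⇒nonZero)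
open import Data.Nat.DivMod using (_mod_)
open import Data.Fin using (Fin; toℕ; _≟_)
open import Data.Vec using (Vec; zipWith)
open import Data.Product using (Σ; ∃; _,_; proj₁)
open import Relation.Nullary using (does)
open import Data.Bool using (if_then_else_)
open import Relation.Binary.PropositionalEquality using (_≡_)
open import Relation.Unary using (Pred)

addℤ : {p : ℕ} → Prime p → Fin p → Fin p → Fin p
addℤ {p} pr x y = let instance _ = prime⇒nonZero pr in (toℕ x + toℕ y) mod p

ℤ^ : ℕ → ℕ → Set
ℤ^ p s = Vec (Fin p) s

addVec : {p s : ℕ} → Prime p → ℤ^ p s → ℤ^ p s → ℤ^ p s
addVec pr = zipWith (addℤ pr)

-- a subset S ⊆ A is a proof-irrelevant predicate on A
IsSubset : {a ℓ : Level} {A : Set a} → Pred A ℓ → Set _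
IsSubset {A = A} S = (x : A) (u v : S x) → u ≡ v

Surjective : {a ℓ b : Level} {A : Set a} {B : Set b} (S : Pred A ℓ) →
             (Σ A S → B) → Set _
Surjective {A = A} S φ = ∀ y → Σ (Σ A S) (λ z → φ z ≡ y)

RelR : {a ℓ : Level} {A : Set a} {p s : ℕ} (pr : Prime p) (S : Pred A ℓ) →
       (Σ A S → ℤ^ p s) → Pred (Fin 4 → A) _
RelR {A = A} pr S φ t =
  Σ (S (t 0F)) λ s₁ → Σ (S (t 1F)) λ s₂ → Σ (S (t 2F)) λ s₃ → Σ (S (t 3F)) λ s₄ →
    addVec pr (φ (t 0F , s₁)) (φ (t 1F , s₂)) ≡ addVec pr (φ (t 2F , s₃)) (φ (t 3F , s₄))
  where open import Data.Fin using (#_)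
        0F 1F 2F 3F : Fin 4
        0F = # 0
        1F = # 1
        2F = # 2
        3F = # 3

Op : {a : Level} → Set a → ℕ → Set a
Op A n = (Fin n → A) → A

Idempotent : {a : Level} {A : Set a} {n : ℕ} → Op A n → Set a
Idempotent {A = A} w = (x : A) → w (λ _ → x) ≡ x

oneAt : {a : Level} {A : Set a} {n : ℕ} → Fin n → A → A → Fin n → A
oneAt i x y k = if does (k ≟ i) then y else x

IsWNU : {a : Level} {A : Set a} {n : ℕ} → Op A n → Set a
IsWNU {A = A} {n} w = (2 ≤ n) Data.Product.× ((x y : A) (i j : Fin n) → w (oneAt i x y) ≡ w (oneAt j x y))
  where import Data.Product

Preserves : {a ℓ : Level} {A : Set a} {n m : ℕ} → Op A n → Pred (Fin m → A) ℓ → Set _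
Preserves {A = A} {n = n} {m} w R =
  (t : Fin n → Fin m → A) → (∀ i → R (t i)) → R (λ k → w (λ i → t i k))

-- Pick a₀, a₁ ∈ S with φ(a₀) = 0 and φ(a₁) = e₁, and give a mask c ⊆ {1,…,n} the
-- weight: the first coordinate of φ(w(a_{c(1)},…,a_{c(n)})). Applying w to the rows
-- (a_{c₀(i)}, a₀, a_{c₂(i)}, a_{c₃(i)}) of R, where c₀ is the disjoint union of c₂ and
-- c₃, and using w(a₀,…,a₀) = a₀, shows that the weight is additive modulo p. The WNU
-- identities give all singleton masks the same weight γ, so the full mask has weight
-- nγ ≡ 0 as p ∣ n; by idempotence its weight is the first coordinate of e₁, namely 1.
module Submission where

open import Defs
open import Level using (0ℓ)
open import Data.Bool using (Bool; true; false; if_then_else_)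
open import Data.Empty using (⊥-elim)
open import Data.Fin using (Fin; toℕ; _≟_; fromℕ<)
open import Data.Fin.Properties using (toℕ-fromℕ<; toℕ-injective; toℕ<n)
open import Data.Nat using (ℕ; zero; suc; _+_; _*_; _%_; _<ᵇ_; _<_; _≤_; _≥_; NonZero; nonTrivial⇒n>1)
open import Data.Nat.DivMod using (_mod_; %-distribˡ-+; m<n⇒m%n≡m)
open import Data.Nat.Divisibility using (_∣_; n∣m⇒m%n≡0; ∣m⇒∣m*n)
open import Data.Nat.Primality using (Prime; prime⇒nonZero; prime⇒nonTrivial)
open import Data.Nat.Properties using (+-comm; +-identityʳ; ≤-refl; <⇒≤; <⇒<ᵇ)
open import Data.Product using (Σ; _,_; proj₁; proj₂)
open import Data.Vec using (_∷_; head; replicate)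
open import Data.Vec.Functional using ([]) renaming (_∷_ to _◂_)
open import Data.Vec.Properties using (zipWith-comm)
open import Relation.Binary.PropositionalEquality using (_≡_; _≢_; refl; sym; trans; cong; cong₂; module ≡-Reasoning)
open import Relation.Nullary using (¬_; does; yes; no)
open import Relation.Unary using (Pred)

n<ᵇn≡false : ∀ n → (n <ᵇ n) ≡ false
n<ᵇn≡false zero    = refl
n<ᵇn≡false (suc n) = n<ᵇn≡false n

n<ᵇ1+n≡true : ∀ n → (n <ᵇ suc n) ≡ true
n<ᵇ1+n≡true zero    = refl
n<ᵇ1+n≡true (suc n) = n<ᵇ1+n≡true n

m≢n⇒m<ᵇ1+n≡m<ᵇn : ∀ {m n} → m ≢ n → (m <ᵇ suc n) ≡ (m <ᵇ n)
m≢n⇒m<ᵇ1+n≡m<ᵇn {zero}  {zero}  m≢n = ⊥-elim (m≢n refl)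
m≢n⇒m<ᵇ1+n≡m<ᵇn {zero}  {suc n} m≢n = refl
m≢n⇒m<ᵇ1+n≡m<ᵇn {suc m} {zero}  m≢n = refl
m≢n⇒m<ᵇ1+n≡m<ᵇn {suc m} {suc n} m≢n = m≢n⇒m<ᵇ1+n≡m<ᵇn (λ m≡n → m≢n (cong suc m≡n))

-- b₀ is the disjoint union of b₂ and b₃
data Split : Bool → Bool → Bool → Set where
  left  : Split true true false
  right : Split true false true
  none  : Split false false false

split-diag : ∀ b → Split b b false
split-diag true  = left
split-diag false = none

prefix : ∀ {n} → ℕ → Fin n → Bool
prefix m i = toℕ i <ᵇ m

unit : ∀ {n} → Fin n → Fin n → Bool
unit k i = does (i ≟ k)

split-prefix-suc : ∀ {n m} (k i : Fin n) → toℕ k ≡ m → Split (prefix (suc m) i) (prefix m i) (unit k i)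
split-prefix-suc k i refl with i ≟ k
... | yes refl rewrite n<ᵇ1+n≡true (toℕ i) | n<ᵇn≡false (toℕ i) = right
... | no i≢k   rewrite m≢n⇒m<ᵇ1+n≡m<ᵇn (λ i≡k → i≢k (toℕ-injective i≡k)) = split-diag (prefix (toℕ k) i)

split-prefix-full : ∀ {n} (i : Fin n) → Split (prefix n i) true false
split-prefix-full {n} i with toℕ i <ᵇ n | <⇒<ᵇ (toℕ<n i)
... | true  | _  = left
... | false | ()

module _ {A : Set} {S : Pred A 0ℓ} (irr : IsSubset S) {p s : ℕ} (pr : Prime p)
         (φ : Σ A S → ℤ^ p (suc s)) where

  private instance
    p≢0 : NonZero p
    p≢0 = prime⇒nonZero pr

  φ₁ : (a : A) → S a → ℕ
  φ₁ a sa = toℕ (head (φ (a , sa)))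

  φ₁-cong : ∀ {a b} → a ≡ b → (sa : S a) (sb : S b) → φ₁ a sa ≡ φ₁ b sb
  φ₁-cong {a} refl sa sb = cong (φ₁ a) (irr a sa sb)

  head-addVec : (u v : ℤ^ p (suc s)) → toℕ (head (addVec pr u v)) ≡ (toℕ (head u) + toℕ (head v)) % p
  head-addVec (x ∷ _) (y ∷ _) = toℕ-fromℕ< _

  addVec-comm : (u v : ℤ^ p (suc s)) → addVec pr u v ≡ addVec pr v u
  addVec-comm = zipWith-comm (λ x y → cong (_mod p) (+-comm (toℕ x) (toℕ y)))

  %-congˡ-+ : ∀ {a b} c → a % p ≡ b % p → (a + c) % p ≡ (b + c) % p
  %-congˡ-+ {a} {b} c a≡b = begin
    (a + c) % p           ≡⟨ %-distribˡ-+ a c p ⟩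
    (a % p + c % p) % p   ≡⟨ cong (λ x → (x + c % p) % p) a≡b ⟩
    (b % p + c % p) % p   ≡⟨ sym (%-distribˡ-+ b c p) ⟩
    (b + c) % p           ∎
    where open ≡-Reasoning

  module WNUCounting {n} (w : Op A n) (idem : Idempotent w) (wnu : IsWNU w)
                     (pres : Preserves w (RelR pr S φ))
                     {a₀ a₁ : A} (s₀ : S a₀) (s₁ : S a₁) (φ₁a₀≡0 : φ₁ a₀ s₀ ≡ 0) where

    sel : Bool → A
    sel b = if b then a₁ else a₀

    sel-∈S : ∀ b → S (sel b)
    sel-∈S true  = s₁
    sel-∈S false = s₀

    row : Bool → Bool → Bool → Fin 4 → A
    row b₀ b₂ b₃ = sel b₀ ◂ a₀ ◂ sel b₂ ◂ sel b₃ ◂ []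

    split-row : ∀ {b₀ b₂ b₃} → Split b₀ b₂ b₃ → RelR pr S φ (row b₀ b₂ b₃)
    split-row left  = s₁ , s₀ , s₁ , s₀ , refl
    split-row right = s₁ , s₀ , s₀ , s₁ , addVec-comm _ _
    split-row none  = s₀ , s₀ , s₀ , s₀ , refl

    image : (Fin n → Bool) → A
    image c = w (λ i → sel (c i))

    image-∈S : ∀ c → S (image c)
    image-∈S c = proj₁ (pres (λ i → row (c i) (c i) false) (λ i → split-row (split-diag (c i))))

    weight : (Fin n → Bool) → ℕ
    weight c = φ₁ (image c) (image-∈S c)

    φ₁-idem : ∀ {a} (sa : S a) (t : S (w (λ _ → a))) → φ₁ _ t ≡ φ₁ a sa
    φ₁-idem {a} sa t = φ₁-cong (idem a) t sa

    φ₁-idem₀ : (t : S (w (λ _ → a₀))) → φ₁ _ t ≡ 0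
    φ₁-idem₀ t = trans (φ₁-idem s₀ t) φ₁a₀≡0

    weight-additive : ∀ {c₀ c₂ c₃} → (∀ i → Split (c₀ i) (c₂ i) (c₃ i)) →
                      weight c₀ % p ≡ (weight c₂ + weight c₃) % p
    weight-additive {c₀} {c₂} {c₃} split with pres (λ i → row (c₀ i) (c₂ i) (c₃ i)) (λ i → split-row (split i))
    ... | t₀ , t₁ , t₂ , t₃ , eq = begin
      weight c₀ % p
        ≡⟨ cong (_% p) (sym (+-identityʳ _)) ⟩
      (weight c₀ + 0) % p
        ≡⟨ cong₂ (λ x y → (x + y) % p) (φ₁-cong refl _ t₀) (sym (φ₁-idem₀ t₁)) ⟩
      (φ₁ (image c₀) t₀ + φ₁ (w (λ _ → a₀)) t₁) % p
        ≡⟨ sym (head-addVec (φ (image c₀ , t₀)) (φ (w (λ _ → a₀) , t₁))) ⟩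
      toℕ (head (addVec pr (φ (image c₀ , t₀)) (φ (w (λ _ → a₀) , t₁))))
        ≡⟨ cong (λ v → toℕ (head v)) eq ⟩
      toℕ (head (addVec pr (φ (image c₂ , t₂)) (φ (image c₃ , t₃))))
        ≡⟨ head-addVec (φ (image c₂ , t₂)) (φ (image c₃ , t₃)) ⟩
      (φ₁ (image c₂) t₂ + φ₁ (image c₃) t₃) % p
        ≡⟨ cong₂ (λ x y → (x + y) % p) (φ₁-cong refl t₂ _) (φ₁-cong refl t₃ _) ⟩
      (weight c₂ + weight c₃) % p ∎
      where open ≡-Reasoning

    weight-unit : ∀ j k → weight (unit j) ≡ weight (unit k)
    weight-unit j k = φ₁-cong (proj₂ wnu a₀ a₁ j k) _ _

    weight-prefix : ∀ m → m ≤ n → (k : Fin n) → weight (prefix m) % p ≡ (m * weight (unit k)) % p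
    weight-prefix zero    _   k = cong (_% p) (φ₁-idem₀ _)
    weight-prefix (suc m) m<n k = begin
      weight (prefix (suc m)) % p        ≡⟨ weight-additive (λ i → split-prefix-suc j i (toℕ-fromℕ< m<n)) ⟩
      (weight (prefix m) + weight (unit j)) % p
                                         ≡⟨ %-congˡ-+ (weight (unit j)) (weight-prefix m (<⇒≤ m<n) k) ⟩
      (m * γ + weight (unit j)) % p      ≡⟨ cong (λ x → (m * γ + x) % p) (weight-unit j k) ⟩
      (m * γ + γ) % p                    ≡⟨ cong (_% p) (+-comm (m * γ) γ) ⟩
      (suc m * γ) % p                    ∎
      where open ≡-Reasoning
            j : Fin n
            j = fromℕ< m<n
            γ : ℕ
            γ = weight (unit k)

    φ₁a₁≡n*weight-unit : (k : Fin n) → φ₁ a₁ s₁ % p ≡ (n * weight (unit k)) % p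
    φ₁a₁≡n*weight-unit k = begin
      φ₁ a₁ s₁ % p                                    ≡⟨ cong (_% p) (sym (+-identityʳ _)) ⟩
      (φ₁ a₁ s₁ + 0) % p
        ≡⟨ cong₂ (λ x y → (x + y) % p) (sym (φ₁-idem s₁ _)) (sym (φ₁-idem₀ _)) ⟩
      (weight (λ _ → true) + weight (λ _ → false)) % p ≡⟨ sym (weight-additive split-prefix-full) ⟩
      weight (prefix n) % p                           ≡⟨ weight-prefix n ≤-refl k ⟩
      (n * weight (unit k)) % p                       ∎
      where open ≡-Reasoning

    φ₁a₁%p≡0 : p ∣ n → φ₁ a₁ s₁ % p ≡ 0
    φ₁a₁%p≡0 p∣n = trans (φ₁a₁≡n*weight-unit k) (n∣m⇒m%n≡0 _ p (∣m⇒∣m*n _ p∣n))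
      where k : Fin n
            k = fromℕ< (proj₁ wnu)

mainTheorem12 : (A : Set) (S : Pred A 0ℓ) → IsSubset S →
    (p : ℕ) (pr : Prime p) (s : ℕ) → s ≥ 1 →
    (φ : Σ A S → ℤ^ p s) → Surjective S φ →
    (n : ℕ) (w : Op A n) → p ∣ n → Idempotent w → IsWNU w →
    ¬ Preserves w (RelR pr S φ)
mainTheorem12 A S irr p pr zero () φ surj n w p∣n idem wnu pres
mainTheorem12 A S irr p pr (suc s) _ φ surj n w p∣n idem wnu pres = 1≢0 (begin
  1                      ≡⟨ sym (m<n⇒m%n≡m 1<p) ⟩
  1 % p                  ≡⟨ cong (_% p) (sym φ₁a₁≡1) ⟩
  φ₁ irr pr φ a₁ s₁ % p  ≡⟨ φ₁a₁%p≡0 p∣n ⟩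
  0                      ∎)
  where
    open ≡-Reasoning
    instance
      p≢0 : NonZero p
      p≢0 = prime⇒nonZero pr
    1<p : 1 < p
    1<p = nonTrivial⇒n>1 p {{prime⇒nonTrivial pr}}
    0ₚ 1ₚ : Fin p
    0ₚ = fromℕ< (<⇒≤ 1<p)
    1ₚ = fromℕ< 1<p
    1≢0 : 1 ≢ 0
    1≢0 ()
    Preimage : ℤ^ p (suc s) → Set
    Preimage v = Σ (Σ A S) (λ a → φ a ≡ v)
    zero-preimage : Preimage (replicate (suc s) 0ₚ)
    zero-preimage = surj _
    e₁-preimage : Preimage (1ₚ ∷ replicate s 0ₚ)
    e₁-preimage = surj _
    a₀ a₁ : A
    a₀ = proj₁ (proj₁ zero-preimage)
    a₁ = proj₁ (proj₁ e₁-preimage)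
    s₀ : S a₀
    s₀ = proj₂ (proj₁ zero-preimage)
    s₁ : S a₁
    s₁ = proj₂ (proj₁ e₁-preimage)
    φ₁a₀≡0 : φ₁ irr pr φ a₀ s₀ ≡ 0
    φ₁a₀≡0 = trans (cong (λ v → toℕ (head v)) (proj₂ zero-preimage)) (toℕ-fromℕ< _)
    φ₁a₁≡1 : φ₁ irr pr φ a₁ s₁ ≡ 1
    φ₁a₁≡1 = trans (cong (λ v → toℕ (head v)) (proj₂ e₁-preimage)) (toℕ-fromℕ< _)
    open WNUCounting irr pr φ w idem wnu pres s₀ s₁ φ₁a₀≡0
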